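{- Let $G$ be a finite group and let $p,q$ be distinct prime numbers. Then $\mathcal{P}_e(G)$ is a chordal graph and a cograph if one of the following holds: (a) $\pi_e(G)=\{1,p,q,pq\}$ and $G$ has a unique subgroup of order $p$ or a unique subgroup of order $q$; (b) $\pi_e(G)=\{1,p,q,pq\}$ and either $G$ has a unique cyclic subgroup of order $pq$, or the intersection of all cyclic subgroups of $G$ of order $pq$ has size $p$ or $q$; (c) $\pi_e(G)=\{1,p,q,pq,p^2\}$ and either $G$ has a unique cyclic subgroup of order $pq$, or the intersection of all cyclic subgroups of $G$ of order $pq$ is $\langle a\rangle$ for some $a\in \mathrm{Cyc}(G)$ with $o(a)\in\{p,q\}$.
   Context: $\pi_e(G)$ denotes the set of orders of elements of $G$, and $o(g)$ the order of $g$. The cyclicizer of $G$ is $\mathrm{Cyc}(G)=\{g\in G : \langle g,x\rangle \text{ is cyclic for every } x\in G\}$. For a finite group $G$, the enhanced power graph $\mathcal{P}_e(G)$ is the simple graph with vertex set $G$ in which two distinct vertices $x,y$ are adjacent if and only if $\langle x,y\rangle$ is cyclic. A graph is chordal if it has no induced cycle of length greater than $3$; it is a cograph if it has no induced subgraph isomorphic to the path $P_4$ on four vertices. -}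

module Defs where

open import Level using (0ℓ)
open import Data.Nat using (ℕ; zero; suc; _+_; _*_; _<_; _≤_)
open import Data.Fin using (Fin; toℕ)
open import Data.Fin.Subset using (Subset; _∈_; ∣_∣)
open import Data.Product using (Σ; ∃; ∃-syntax; _×_; _,_)
open import Data.Sum using (_⊎_)
open import Relation.Nullary using (¬_)
open import Relation.Binary.PropositionalEquality using (_≡_; _≢_)
open import Algebra.Structures using (IsGroup)
open import Function.Definitions using (Injective)
open import Function.Bundles using (_⇔_)

-- A finite group: a group structure (with propositional equality) on Fin n.
-- Every finite group is isomorphic to one of these.
record FinGroup : Set₁ where
  field
    n       : ℕ
    _∙_     : Fin n → Fin n → Fin n
    e       : Fin n
    inv     : Fin n → Fin n
    isGroup : IsGroup _≡_ _∙_ e inv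

module _ (G : FinGroup) where
  open FinGroup G

  Elem : Set
  Elem = Fin n

  pow : Elem → ℕ → Elem
  pow g zero    = e
  pow g (suc k) = g ∙ pow g k

  HasOrder : Elem → ℕ → Set
  HasOrder g k = (0 < k) × (pow g k ≡ e) × (∀ j → 0 < j → j < k → pow g j ≢ e)

  InSpectrum : ℕ → Set
  InSpectrum k = ∃[ g ] HasOrder g k

  data Gen (S : Elem → Set) : Elem → Set where
    gen-base : ∀ {s} → S s → Gen S s
    gen-e    : Gen S e
    gen-mul  : ∀ {a b} → Gen S a → Gen S b → Gen S (a ∙ b)
    gen-inv  : ∀ {a} → Gen S a → Gen S (inv a)

  Gen₁ : Elem → Elem → Set
  Gen₁ z = Gen (λ g → g ≡ z)

  Gen₂ : Elem → Elem → Elem → Set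
  Gen₂ x y = Gen (λ g → g ≡ x ⊎ g ≡ y)

  IsCyclic : (Elem → Set) → Set
  IsCyclic P = ∃[ z ] (∀ g → P g ⇔ Gen₁ z g)

  InCyc : Elem → Set
  InCyc a = ∀ x → IsCyclic (Gen₂ a x)

  IsSubgroup : Subset n → Set
  IsSubgroup H = (e ∈ H) × (∀ a b → a ∈ H → b ∈ H → (a ∙ b) ∈ H)
                 × (∀ a → a ∈ H → inv a ∈ H)

  IsCyclicSubgroup : Subset n → Set
  IsCyclicSubgroup H = IsSubgroup H × IsCyclic (λ g → g ∈ H)

  UniqueSubgroupOfOrder : ℕ → Set
  UniqueSubgroupOfOrder k =
    ∃[ H ] (IsSubgroup H × ∣ H ∣ ≡ k
            × (∀ K → IsSubgroup K → ∣ K ∣ ≡ k → K ≡ H))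

  UniqueCyclicSubgroupOfOrder : ℕ → Set
  UniqueCyclicSubgroupOfOrder k =
    ∃[ H ] (IsCyclicSubgroup H × ∣ H ∣ ≡ k
            × (∀ K → IsCyclicSubgroup K → ∣ K ∣ ≡ k → K ≡ H))

  InCycIntersection : ℕ → Elem → Set
  InCycIntersection k g = ∀ H → IsCyclicSubgroup H → ∣ H ∣ ≡ k → g ∈ H

  -- enhanced power graph adjacency
  Adj : Elem → Elem → Set
  Adj x y = (x ≢ y) × IsCyclic (Gen₂ x y)

  Consec : {k : ℕ} → Fin k → Fin k → Set
  Consec {k} i j = Next i j ⊎ Next j i
    where
    Next : Fin k → Fin k → Set
    Next a b = (toℕ b ≡ suc (toℕ a)) ⊎ ((suc (toℕ a) ≡ k) × (toℕ b ≡ 0))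

  InducedCycle : (k : ℕ) → (Fin k → Elem) → Set
  InducedCycle k c = Injective _≡_ _≡_ c
                     × (∀ i j → i ≢ j → (Adj (c i) (c j) ⇔ Consec i j))

  Chordal : Set
  Chordal = ∀ k → 4 ≤ k → (c : Fin k → Elem) → ¬ InducedCycle k c

  InducedP4 : Elem → Elem → Elem → Elem → Set
  InducedP4 a b c d =
    (a ≢ b) × (a ≢ c) × (a ≢ d) × (b ≢ c) × (b ≢ d) × (c ≢ d)
    × Adj a b × Adj b c × Adj c d
    × ¬ Adj a c × ¬ Adj a d × ¬ Adj b d

  Cograph : Set
  Cograph = ∀ a b c d → ¬ InducedP4 a b c d

  SpectrumPQ : ℕ → ℕ → Set
  SpectrumPQ p q = ∀ k → InSpectrum k ⇔ (k ≡ 1 ⊎ k ≡ p ⊎ k ≡ q ⊎ k ≡ p * q)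

  SpectrumPQP2 : ℕ → ℕ → Set
  SpectrumPQP2 p q =
    ∀ k → InSpectrum k ⇔ (k ≡ 1 ⊎ k ≡ p ⊎ k ≡ q ⊎ k ≡ p * q ⊎ k ≡ p * p)

  CondA : ℕ → ℕ → Set
  CondA p q = SpectrumPQ p q × (UniqueSubgroupOfOrder p ⊎ UniqueSubgroupOfOrder q)

  CondB : ℕ → ℕ → Set
  CondB p q = SpectrumPQ p q ×
    (UniqueCyclicSubgroupOfOrder (p * q)
     ⊎ ∃[ I ] ((∀ g → g ∈ I ⇔ InCycIntersection (p * q) g)
               × (∣ I ∣ ≡ p ⊎ ∣ I ∣ ≡ q)))

  CondC : ℕ → ℕ → Set
  CondC p q = SpectrumPQP2 p q ×
    (UniqueCyclicSubgroupOfOrder (p * q)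
     ⊎ ∃[ a ] (InCyc a × (HasOrder a p ⊎ HasOrder a q)
               × (∀ g → InCycIntersection (p * q) g ⇔ Gen₁ a g)))

-- In each case there are distinct primes r, s with {r, s} = {p, q} such that every element
-- order lies in {1, r, s, rs, r²} and some element a of order r lies in every cyclic subgroup
-- of order rs: a generates the unique subgroup of order r, or is the q-th power of a generator
-- of the unique cyclic subgroup of order pq, or is a nontrivial element of the intersection
-- (whose order cannot be pq, the intersection being too small). In (c) the element a ∈ Cyc(G)
-- cannot have order q, for with an element of order p² it would generate a cyclic group of
-- order divisible by p²q.
-- Given such an a, the closed neighbourhoods of adjacent vertices x, y ∈ ⟨z⟩ are nested:
-- if o(x) ∣ o(y) then x ∈ ⟨y⟩; otherwise o(x) = r, o(y) = s, o(z) = rs, and whenever y, u ∈ ⟨w⟩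
-- either ⟨w⟩ = ⟨y⟩ ⊆ ⟨z⟩ ∋ x, or o(w) = rs and x ∈ ⟨a⟩ ⊆ ⟨w⟩. A graph whose adjacent vertices
-- have nested closed neighbourhoods has no induced P₄ and no induced cycle of length ≥ 4.

module Submission where

open import Defs
open import Level using (0ℓ)
open import Algebra.Bundles using (Group)
open import Data.Bool.Properties using (T-≡)
open import Data.Empty using (⊥-elim)
open import Data.Fin as Fin using (Fin; toℕ; fromℕ<; #_; punchIn; punchOut)
import Data.Fin.Properties as Finₚ
open import Data.Fin.Subset using (Subset; _∈_; ∣_∣; ⁅_⁆; inside; outside)
open import Data.Fin.Subset.Properties using (_∈?_; drop-there; x∈⁅x⁆; ∣⁅x⁆∣≡1; p⊆q⇒∣p∣≤∣q∣)
open import Data.Nat using (ℕ; zero; suc; _+_; _*_; _∸_; _≤_; _<_; s≤s; z≤n; NonZero; >-nonZero; >-nonZero⁻¹; _<?_; nonTrivial⇒n>1)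
open import Data.Nat.Properties
open import Data.Nat.Divisibility
open import Data.Nat.DivMod using (_%_; _/_; m≡m%n+[m/n]*n; m%n<n)
open import Data.Nat.GCD using (gcd; gcd-GCD; gcd[m,n]∣m; gcd[m,n]∣n; module Bézout)
open import Data.Nat.Primality using (Prime; ¬prime[1]; euclidsLemma; prime⇒irreducible; prime⇒nonZero; prime⇒nonTrivial)
open import Data.Product using (∃; _×_; _,_; proj₁; proj₂)
open import Data.Sum using (_⊎_; inj₁; inj₂; [_,_]′)
open import Data.Vec using (_∷_; []; here; there; tabulate)
open import Data.Vec.Properties using ([]=⇒lookup; lookup⇒[]=; lookup∘tabulate)
open import Function.Base using (_∘_; case_of_)
open import Function.Bundles using (_⇔_; mk⇔; Equivalence)
open import Function.Definitions using (Injective)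
open import Relation.Nullary using (¬_; Dec; yes; no)
open import Relation.Nullary.Decidable using (isYes; toWitness; fromWitness; _×-dec_; ¬?)
open import Relation.Unary using (Pred; Decidable; _⊆_)
open import Relation.Binary.Definitions using (tri<; tri≈; tri>)
open import Relation.Binary.PropositionalEquality

Admissible : ℕ → ℕ → ℕ → Set
Admissible r s k = k ≡ 1 ⊎ k ≡ r ⊎ k ≡ s ⊎ k ≡ r * s ⊎ k ≡ r * r

pattern is-1  = inj₁ refl
pattern is-r  = inj₂ (inj₁ refl)
pattern is-s  = inj₂ (inj₂ (inj₁ refl))
pattern is-rs = inj₂ (inj₂ (inj₂ (inj₁ refl)))
pattern is-rr = inj₂ (inj₂ (inj₂ (inj₂ refl)))

prime∤1 : ∀ {p} → Prime p → ¬ p ∣ 1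
prime∤1 p-prime p∣1 = ¬prime[1] (subst Prime (∣1⇒≡1 p∣1) p-prime)

prime∣prime⇒≡ : ∀ {p q} → Prime p → Prime q → p ∣ q → p ≡ q
prime∣prime⇒≡ p-prime q-prime p∣q with prime⇒irreducible q-prime p∣q
... | inj₁ refl = ⊥-elim (¬prime[1] p-prime)
... | inj₂ p≡q  = p≡q

module AdmissibleOrders {r s : ℕ} (r-prime : Prime r) (s-prime : Prime s) (r≢s : r ≢ s) where

  r∤s : ¬ r ∣ s
  r∤s r∣s = r≢s (prime∣prime⇒≡ r-prime s-prime r∣s)

  s∤r : ¬ s ∣ r
  s∤r s∣r = r≢s (sym (prime∣prime⇒≡ s-prime r-prime s∣r))

  s∤r*r : ¬ s ∣ r * r
  s∤r*r s∣r*r with euclidsLemma r r s-prime s∣r*r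
  ... | inj₁ s∣r = s∤r s∣r
  ... | inj₂ s∣r = s∤r s∣r

  r*r∣∧s∣⇒¬admissible : ∀ {k} → r * r ∣ k → s ∣ k → ¬ Admissible r s k
  r*r∣∧s∣⇒¬admissible r*r∣k s∣k is-1  = prime∤1 s-prime s∣k
  r*r∣∧s∣⇒¬admissible r*r∣k s∣k is-r  = s∤r s∣k
  r*r∣∧s∣⇒¬admissible r*r∣k s∣k is-s  = r∤s (∣-trans (m∣m*n r) r*r∣k)
  r*r∣∧s∣⇒¬admissible r*r∣k s∣k is-rs = r∤s (*-cancelˡ-∣ r {{prime⇒nonZero r-prime}} r*r∣k)
  r*r∣∧s∣⇒¬admissible r*r∣k s∣k is-rr = s∤r*r s∣k

  s∣⇒≡s⊎≡r*s : ∀ {k} → s ∣ k → Admissible r s k → k ≡ s ⊎ k ≡ r * s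
  s∣⇒≡s⊎≡r*s s∣k is-1  = ⊥-elim (prime∤1 s-prime s∣k)
  s∣⇒≡s⊎≡r*s s∣k is-r  = ⊥-elim (s∤r s∣k)
  s∣⇒≡s⊎≡r*s s∣k is-s  = inj₁ refl
  s∣⇒≡s⊎≡r*s s∣k is-rs = inj₂ refl
  s∣⇒≡s⊎≡r*s s∣k is-rr = ⊥-elim (s∤r*r s∣k)

  r∣∧s∣⇒≡r*s : ∀ {k} → r ∣ k → s ∣ k → Admissible r s k → k ≡ r * s
  r∣∧s∣⇒≡r*s r∣k s∣k adm with s∣⇒≡s⊎≡r*s s∣k adm
  ... | inj₁ refl = ⊥-elim (r∤s r∣k)
  ... | inj₂ k≡rs = k≡rs

  incomparable⇒r,s : ∀ {d d′ k} → Admissible r s d → Admissible r s d′ → Admissible r s k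
                   → d ∣ k → d′ ∣ k → ¬ d ∣ d′ → ¬ d′ ∣ d
                   → (d ≡ r × d′ ≡ s) ⊎ (d ≡ s × d′ ≡ r)
  incomparable⇒r,s is-1  _     _ _ _ 1∤ _ = ⊥-elim (1∤ (1∣ _))
  incomparable⇒r,s _     is-1  _ _ _ _ 1∤ = ⊥-elim (1∤ (1∣ _))
  incomparable⇒r,s is-r  is-r  _ _ _ ∤ _ = ⊥-elim (∤ ∣-refl)
  incomparable⇒r,s is-r  is-s  _ _ _ _ _ = inj₁ (refl , refl)
  incomparable⇒r,s is-r  is-rs _ _ _ ∤ _ = ⊥-elim (∤ (m∣m*n s))
  incomparable⇒r,s is-r  is-rr _ _ _ ∤ _ = ⊥-elim (∤ (m∣m*n r))
  incomparable⇒r,s is-s  is-r  _ _ _ _ _ = inj₂ (refl , refl)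
  incomparable⇒r,s is-s  is-s  _ _ _ ∤ _ = ⊥-elim (∤ ∣-refl)
  incomparable⇒r,s is-s  is-rs _ _ _ ∤ _ = ⊥-elim (∤ (n∣m*n r))
  incomparable⇒r,s is-s  is-rr k s∣k rr∣k _ _ = ⊥-elim (r*r∣∧s∣⇒¬admissible rr∣k s∣k k)
  incomparable⇒r,s is-rs is-r  _ _ _ _ ∤ = ⊥-elim (∤ (m∣m*n s))
  incomparable⇒r,s is-rs is-s  _ _ _ _ ∤ = ⊥-elim (∤ (n∣m*n r))
  incomparable⇒r,s is-rs is-rs _ _ _ ∤ _ = ⊥-elim (∤ ∣-refl)
  incomparable⇒r,s is-rs is-rr k rs∣k rr∣k _ _ =
    ⊥-elim (r*r∣∧s∣⇒¬admissible rr∣k (∣-trans (n∣m*n r) rs∣k) k)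
  incomparable⇒r,s is-rr is-r  _ _ _ _ ∤ = ⊥-elim (∤ (m∣m*n r))
  incomparable⇒r,s is-rr is-s  k rr∣k s∣k _ _ = ⊥-elim (r*r∣∧s∣⇒¬admissible rr∣k s∣k k)
  incomparable⇒r,s is-rr is-rs k rr∣k rs∣k _ _ =
    ⊥-elim (r*r∣∧s∣⇒¬admissible rr∣k (∣-trans (n∣m*n r) rs∣k) k)
  incomparable⇒r,s is-rr is-rr _ _ _ ∤ _ = ⊥-elim (∤ ∣-refl)

prime>1 : ∀ {p} → Prime p → 1 < p
prime>1 {p} p-prime = nonTrivial⇒n>1 p {{prime⇒nonTrivial p-prime}}

subset : ∀ {n} {Q : Pred (Fin n) 0ℓ} → Decidable Q → Subset n
subset Q? = tabulate (isYes ∘ Q?)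

∈-subset : ∀ {n} {Q : Pred (Fin n) 0ℓ} (Q? : Decidable Q) {x} → x ∈ subset Q? ⇔ Q x
∈-subset Q? {x} = mk⇔
  (λ x∈ → toWitness (Equivalence.from T-≡ (trans (sym (lookup∘tabulate _ x)) ([]=⇒lookup x∈))))
  (λ Qx → lookup⇒[]= x _ (trans (lookup∘tabulate _ x) (Equivalence.to T-≡ (fromWitness Qx))))

_IsImageOf_ : ∀ {m n} → Subset n → (Fin m → Fin n) → Set
S IsImageOf f = ∀ x → x ∈ S ⇔ ∃ λ k → f k ≡ x

private
  drop-zero : ∀ {m n} (f : Fin m → Fin (suc n)) → (∀ k → Fin.zero ≢ f k) → Fin m → Fin n
  drop-zero f 0∉f k = punchOut (0∉f k)

  drop-zero-injective : ∀ {m n} {f : Fin m → Fin (suc n)} (0∉f : ∀ k → Fin.zero ≢ f k)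
                      → Injective _≡_ _≡_ f → Injective _≡_ _≡_ (drop-zero f 0∉f)
  drop-zero-injective 0∉f f-inj eq = f-inj (Finₚ.punchOut-injective (0∉f _) (0∉f _) eq)

  drop-zero-image : ∀ {m n} {f : Fin m → Fin (suc n)} (0∉f : ∀ k → Fin.zero ≢ f k) {S}
                  → (∀ x → x ∈ S ⇔ ∃ λ k → f k ≡ Fin.suc x) → S IsImageOf drop-zero f 0∉f
  drop-zero-image 0∉f img x = mk⇔
    (λ x∈S → let k , fk≡ = Equivalence.to (img x) x∈S
             in k , Finₚ.suc-injective (trans (Finₚ.punchIn-punchOut (0∉f k)) fk≡))
    (λ (k , eq) → Equivalence.from (img x) (k , trans (sym (Finₚ.punchIn-punchOut (0∉f k))) (cong Fin.suc eq)))

∣image∣≡ : ∀ {m n} (S : Subset n) (f : Fin m → Fin n) → Injective _≡_ _≡_ f → S IsImageOf f → ∣ S ∣ ≡ m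
∣image∣≡ [] f f-inj _ = sym (n≤0⇒n≡0 (Finₚ.injective⇒≤ f-inj))
∣image∣≡ (outside ∷ S) f f-inj img =
  ∣image∣≡ S _ (drop-zero-injective 0∉f f-inj) (drop-zero-image 0∉f λ x → mk⇔
    (λ x∈S → Equivalence.to (img (Fin.suc x)) (there x∈S))
    (λ fk≡sucx → drop-there (Equivalence.from (img (Fin.suc x)) fk≡sucx)))
  where
  0∉f : ∀ k → Fin.zero ≢ f k
  0∉f k 0≡fk with Equivalence.from (img Fin.zero) (k , sym 0≡fk)
  ... | ()
∣image∣≡ {zero} (inside ∷ S) f f-inj img with Equivalence.to (img Fin.zero) here
... | () , _
∣image∣≡ {suc m} {suc n} (inside ∷ S) f f-inj img with Equivalence.to (img Fin.zero) here
... | k₀ , fk₀≡0 =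
  cong suc (∣image∣≡ S _ (drop-zero-injective 0∉g g-inj) (drop-zero-image 0∉g λ x → mk⇔
    (λ x∈S → let k , fk≡ = Equivalence.to (img (Fin.suc x)) (there x∈S)
                 k₀≢k = λ k₀≡k → Finₚ.0≢1+n (trans (sym fk₀≡0) (trans (cong f k₀≡k) fk≡))
             in punchOut k₀≢k , trans (cong f (Finₚ.punchIn-punchOut k₀≢k)) fk≡)
    (λ (j , gj≡) → drop-there (Equivalence.from (img (Fin.suc x)) (punchIn k₀ j , gj≡)))))
  where
  g : Fin m → Fin (suc n)
  g = f ∘ punchIn k₀
  g-inj : Injective _≡_ _≡_ g
  g-inj = Finₚ.punchIn-injective k₀ _ _ ∘ f-inj
  0∉g : ∀ k → Fin.zero ≢ g k
  0∉g k 0≡gk = Finₚ.punchInᵢ≢i k₀ k (f-inj (trans (sym 0≡gk) (sym fk₀≡0)))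

∣S∣>1⇒∃≢ : ∀ {n} x (S : Subset n) → 1 < ∣ S ∣ → ∃ λ y → y ∈ S × y ≢ x
∣S∣>1⇒∃≢ x S 1<∣S∣ with Finₚ.any? (λ y → (y ∈? S) ×-dec ¬? (y Finₚ.≟ x))
... | yes found = found
... | no ¬found = ⊥-elim (<⇒≱ 1<∣S∣ (subst (∣ S ∣ ≤_) (∣⁅x⁆∣≡1 x) (p⊆q⇒∣p∣≤∣q∣ S⊆⁅x⁆)))
  where
  S⊆⁅x⁆ : ∀ {y} → y ∈ S → y ∈ ⁅ x ⁆
  S⊆⁅x⁆ {y} y∈S with y Finₚ.≟ x
  ... | yes refl = x∈⁅x⁆ x
  ... | no y≢x   = ⊥-elim (¬found (y , y∈S , y≢x))

module _ (G : FinGroup) where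
  open FinGroup G

  private
    group : Group 0ℓ 0ℓ
    group = record { isGroup = isGroup }

  open Group group using (assoc; identityˡ; identityʳ)
  open import Algebra.Properties.Group group using (∙-cancelˡ; inverseʳ-unique; x≈z//y)

  infixr 30 _^_
  _^_ : Elem G → ℕ → Elem G
  _^_ = pow G

  private variable
    g w x y z : Elem G
    p q : ℕ
    i j k m d d′ : ℕ

  ^-+ : ∀ g i j → g ^ (i + j) ≡ g ^ i ∙ g ^ j
  ^-+ g zero    j = sym (identityˡ _)
  ^-+ g (suc i) j = trans (cong (g ∙_) (^-+ g i j)) (sym (assoc g _ _))

  e^ : ∀ k → e ^ k ≡ e
  e^ zero    = refl
  e^ (suc k) = trans (cong (e ∙_) (e^ k)) (identityˡ e)

  ^-* : ∀ g i j → g ^ (j * i) ≡ (g ^ i) ^ j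
  ^-* g i zero    = refl
  ^-* g i (suc j) = trans (^-+ g i (j * i)) (cong (g ^ i ∙_) (^-* g i j))

  ^≡^⇒^∸≡e : i ≤ j → g ^ i ≡ g ^ j → g ^ (j ∸ i) ≡ e
  ^≡^⇒^∸≡e {i} {j} {g} i≤j gⁱ≡gʲ = sym (∙-cancelˡ (g ^ i) e (g ^ (j ∸ i)) (begin
    g ^ i ∙ e           ≡⟨ identityʳ _ ⟩
    g ^ i               ≡⟨ gⁱ≡gʲ ⟩
    g ^ j               ≡⟨ cong (g ^_) (sym (m+[n∸m]≡n i≤j)) ⟩
    g ^ (i + (j ∸ i))   ≡⟨ ^-+ g i (j ∸ i) ⟩
    g ^ i ∙ g ^ (j ∸ i) ∎))
    where open ≡-Reasoning

  order∣⇒^≡e : HasOrder G g m → m ∣ k → g ^ k ≡ e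
  order∣⇒^≡e {g} {m} (_ , gᵐ≡e , _) (divides q refl) = trans (^-* g m q) (trans (cong (_^ q) gᵐ≡e) (e^ q))

  ^-%order : .{{_ : NonZero m}} → HasOrder G g m → ∀ k → g ^ k ≡ g ^ (k % m)
  ^-%order {m} {g} g-order k = begin
    g ^ k                         ≡⟨ cong (g ^_) (m≡m%n+[m/n]*n k m) ⟩
    g ^ (k % m + k / m * m)       ≡⟨ ^-+ g (k % m) _ ⟩
    g ^ (k % m) ∙ g ^ (k / m * m) ≡⟨ cong (g ^ (k % m) ∙_) (order∣⇒^≡e g-order (n∣m*n (k / m))) ⟩
    g ^ (k % m) ∙ e               ≡⟨ identityʳ _ ⟩
    g ^ (k % m)                   ∎
    where open ≡-Reasoning

  ^≡e⇒order∣ : HasOrder G g m → g ^ k ≡ e → m ∣ k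
  ^≡e⇒order∣ {g} {m} {k} g-order@(m>0 , _ , minimal) gᵏ≡e = m%n≡0⇒n∣m k m (k%m≡0 (k % m) refl)
    where
    instance
      m≢0 : NonZero m
      m≢0 = >-nonZero m>0
    k%m≡0 : ∀ r → k % m ≡ r → r ≡ 0
    k%m≡0 zero    _  = refl
    k%m≡0 (suc r) eq = ⊥-elim (minimal (suc r) (s≤s z≤n) (subst (_< m) eq (m%n<n k m))
                         (trans (cong (g ^_) (sym eq)) (trans (sym (^-%order g-order k)) gᵏ≡e)))

  private
    least-period : ∀ fuel g k → k ≤ fuel → 0 < k → g ^ k ≡ e → ∃ (HasOrder G g)
    least-period zero    g k k≤0 k>0 _ = ⊥-elim (<-irrefl refl (≤-trans k>0 k≤0))
    least-period (suc fuel) g k k≤fuel k>0 gᵏ≡e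
      with Finₚ.any? (λ (j : Fin k) → (0 <? toℕ j) ×-dec (g ^ toℕ j Finₚ.≟ e))
    ... | yes (j , j>0 , gʲ≡e) = least-period fuel g (toℕ j) (≤-pred (≤-trans (Finₚ.toℕ<n j) k≤fuel)) j>0 gʲ≡e
    ... | no ¬smaller = k , k>0 , gᵏ≡e , λ j j>0 j<k gʲ≡e →
          ¬smaller (fromℕ< j<k , subst (0 <_) (sym (Finₚ.toℕ-fromℕ< j<k)) j>0
                               , subst (λ t → g ^ t ≡ e) (sym (Finₚ.toℕ-fromℕ< j<k)) gʲ≡e)

  order-exists : ∀ g → ∃ (HasOrder G g)
  order-exists g with Finₚ.pigeonhole (n<1+n n) (λ (i : Fin (suc n)) → g ^ toℕ i)
  ... | i , j , i<j , gⁱ≡gʲ =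
    least-period (toℕ j ∸ toℕ i) g _ ≤-refl (m<n⇒0<n∸m i<j) (^≡^⇒^∸≡e (<⇒≤ i<j) gⁱ≡gʲ)

  order-^ : HasOrder G w (m * k) → HasOrder G (w ^ k) m
  order-^ {w} {m} {k} w-order@(mk>0 , wᵐᵏ≡e , _) =
    >-nonZero⁻¹ m {{m*n≢0⇒m≢0 m}} , trans (sym (^-* w k m)) wᵐᵏ≡e , λ j j>0 j<m wᵏʲ≡e →
      <⇒≱ j<m (∣⇒≤ {{>-nonZero j>0}} (*-cancelʳ-∣ k {{m*n≢0⇒n≢0 m}}
        (^≡e⇒order∣ w-order (trans (^-* w k j) wᵏʲ≡e))))
    where
    instance
      m*k≢0 : NonZero (m * k)
      m*k≢0 = >-nonZero mk>0

  ^-injective : HasOrder G w m → i < j → j < m → w ^ i ≢ w ^ j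
  ^-injective {w} {m} {i} {j} (_ , _ , minimal) i<j j<m wⁱ≡wʲ =
    minimal (j ∸ i) (m<n⇒0<n∸m i<j) (≤-<-trans (m∸n≤m j i) j<m) (^≡^⇒^∸≡e (<⇒≤ i<j) wⁱ≡wʲ)

  infix 4 _∈⟨_⟩
  _∈⟨_⟩ : Elem G → Elem G → Set
  x ∈⟨ w ⟩ = ∃ λ k → w ^ k ≡ x

  ∈⟨⟩-refl : w ∈⟨ w ⟩
  ∈⟨⟩-refl = 1 , identityʳ _

  ∈⟨⟩-trans : x ∈⟨ y ⟩ → y ∈⟨ w ⟩ → x ∈⟨ w ⟩
  ∈⟨⟩-trans {w = w} (i , refl) (j , refl) = i * j , ^-* w j i

  ∙-∈⟨⟩ : x ∈⟨ w ⟩ → y ∈⟨ w ⟩ → x ∙ y ∈⟨ w ⟩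
  ∙-∈⟨⟩ {w = w} (i , refl) (j , refl) = i + j , ^-+ w i j

  inv-∈⟨⟩ : x ∈⟨ w ⟩ → inv x ∈⟨ w ⟩
  inv-∈⟨⟩ {w = w} (k , refl) with order-exists w
  ... | suc m , w-order = m * k , inverseʳ-unique (w ^ k) _
          (trans (sym (^-+ w k (m * k))) (order∣⇒^≡e w-order (m∣m*n k)))

  ∣⇒^∈⟨^⟩ : i ∣ j → w ^ j ∈⟨ w ^ i ⟩
  ∣⇒^∈⟨^⟩ {w = w} (divides q refl) = q , sym (^-* w _ q)

  ∈⟨⟩⇒order∣ : x ∈⟨ w ⟩ → HasOrder G w m → HasOrder G x d → d ∣ m
  ∈⟨⟩⇒order∣ {w = w} {m} (i , refl) w-order x-order =
    ^≡e⇒order∣ x-order (trans (sym (^-* w i m)) (order∣⇒^≡e w-order (m∣m*n i)))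

  ∈⟨⟩⇒bounded : HasOrder G w m → x ∈⟨ w ⟩ → ∃ λ (k : Fin m) → w ^ toℕ k ≡ x
  ∈⟨⟩⇒bounded {w} {m} w-order@(m>0 , _) (k , wᵏ≡x) =
    fromℕ< k%m<m , trans (cong (w ^_) (Finₚ.toℕ-fromℕ< k%m<m)) (trans (sym (^-%order w-order k)) wᵏ≡x)
    where
    instance
      m≢0 : NonZero m
      m≢0 = >-nonZero m>0
    k%m<m : k % m < m
    k%m<m = m%n<n k m

  _∈⟨_⟩? : ∀ x w → Dec (x ∈⟨ w ⟩)
  x ∈⟨ w ⟩? with order-exists w
  ... | m , w-order with Finₚ.any? (λ (k : Fin m) → w ^ toℕ k Finₚ.≟ x)
  ... | yes (k , wᵏ≡x) = yes (toℕ k , wᵏ≡x)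
  ... | no ¬bounded   = no (¬bounded ∘ ∈⟨⟩⇒bounded w-order)

  ⟨_⟩ˢ : Elem G → Subset n
  ⟨ w ⟩ˢ = subset (_∈⟨ w ⟩?)

  ∈⟨⟩ˢ⇒∈⟨⟩ : x ∈ ⟨ w ⟩ˢ → x ∈⟨ w ⟩
  ∈⟨⟩ˢ⇒∈⟨⟩ {w = w} = Equivalence.to (∈-subset (_∈⟨ w ⟩?))

  ∈⟨⟩⇒∈⟨⟩ˢ : x ∈⟨ w ⟩ → x ∈ ⟨ w ⟩ˢ
  ∈⟨⟩⇒∈⟨⟩ˢ {w = w} = Equivalence.from (∈-subset (_∈⟨ w ⟩?))

  ∣⟨⟩ˢ∣≡order : HasOrder G w m → ∣ ⟨ w ⟩ˢ ∣ ≡ m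
  ∣⟨⟩ˢ∣≡order {w} {m} w-order = ∣image∣≡ ⟨ w ⟩ˢ (λ k → w ^ toℕ k) powers-injective λ x → mk⇔
    (∈⟨⟩⇒bounded w-order ∘ ∈⟨⟩ˢ⇒∈⟨⟩)
    (λ (k , wᵏ≡x) → ∈⟨⟩⇒∈⟨⟩ˢ (toℕ k , wᵏ≡x))
    where
    powers-injective : ∀ {i j : Fin m} → w ^ toℕ i ≡ w ^ toℕ j → i ≡ j
    powers-injective {i} {j} wⁱ≡wʲ with <-cmp (toℕ i) (toℕ j)
    ... | tri< i<j _ _ = ⊥-elim (^-injective w-order i<j (Finₚ.toℕ<n j) wⁱ≡wʲ)
    ... | tri≈ _ i≡j _ = Finₚ.toℕ-injective i≡j
    ... | tri> _ _ j<i = ⊥-elim (^-injective w-order j<i (Finₚ.toℕ<n i) (sym wⁱ≡wʲ))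

  Gen-mono : {S T : Pred (Elem G) 0ℓ} → S ⊆ Gen G T → Gen G S ⊆ Gen G T
  Gen-mono S⊆T (gen-base s)  = S⊆T s
  Gen-mono S⊆T gen-e         = gen-e
  Gen-mono S⊆T (gen-mul a b) = gen-mul (Gen-mono S⊆T a) (Gen-mono S⊆T b)
  Gen-mono S⊆T (gen-inv a)   = gen-inv (Gen-mono S⊆T a)

  Gen-^ : {S : Pred (Elem G) 0ℓ} → ∀ k → Gen G S x → Gen G S (x ^ k)
  Gen-^ zero    _  = gen-e
  Gen-^ (suc k) Sx = gen-mul Sx (Gen-^ k Sx)

  ∈⟨⟩⇒Gen₁ : x ∈⟨ w ⟩ → Gen₁ G w x
  ∈⟨⟩⇒Gen₁ (k , refl) = Gen-^ k (gen-base refl)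

  Gen₁⇒∈⟨⟩ : Gen₁ G w x → x ∈⟨ w ⟩
  Gen₁⇒∈⟨⟩ (gen-base refl) = ∈⟨⟩-refl
  Gen₁⇒∈⟨⟩ gen-e           = 0 , refl
  Gen₁⇒∈⟨⟩ (gen-mul a b)   = ∙-∈⟨⟩ (Gen₁⇒∈⟨⟩ a) (Gen₁⇒∈⟨⟩ b)
  Gen₁⇒∈⟨⟩ (gen-inv a)     = inv-∈⟨⟩ (Gen₁⇒∈⟨⟩ a)

  ⟨⟩ˢ-cyclicSubgroup : ∀ w → IsCyclicSubgroup G ⟨ w ⟩ˢ
  ⟨⟩ˢ-cyclicSubgroup w =
    ( ∈⟨⟩⇒∈⟨⟩ˢ (0 , refl)
    , (λ _ _ a b → ∈⟨⟩⇒∈⟨⟩ˢ (∙-∈⟨⟩ (∈⟨⟩ˢ⇒∈⟨⟩ a) (∈⟨⟩ˢ⇒∈⟨⟩ b)))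
    , (λ _ a → ∈⟨⟩⇒∈⟨⟩ˢ (inv-∈⟨⟩ (∈⟨⟩ˢ⇒∈⟨⟩ a))))
    , w , λ _ → mk⇔ (∈⟨⟩⇒Gen₁ ∘ ∈⟨⟩ˢ⇒∈⟨⟩) (∈⟨⟩⇒∈⟨⟩ˢ ∘ Gen₁⇒∈⟨⟩)

  subgroup-closed-∈⟨⟩ : ∀ {H} → IsSubgroup G H → w ∈ H → x ∈⟨ w ⟩ → x ∈ H
  subgroup-closed-∈⟨⟩ (e∈H , _ , _) w∈H (zero  , refl) = e∈H
  subgroup-closed-∈⟨⟩ H-subgroup@(_ , ∙-closed , _) w∈H (suc k , refl) =
    ∙-closed _ _ w∈H (subgroup-closed-∈⟨⟩ H-subgroup w∈H (k , refl))

  ^-bézout : ∀ w {g a b i j} → g + b * j ≡ a * i → w ^ g ≡ (w ^ i) ^ a ∙ inv ((w ^ j) ^ b)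
  ^-bézout w {g} {a} {b} {i} {j} eq = x≈z//y _ _ _ (begin
    w ^ g ∙ (w ^ j) ^ b ≡⟨ cong (w ^ g ∙_) (sym (^-* w j b)) ⟩
    w ^ g ∙ w ^ (b * j) ≡⟨ sym (^-+ w g (b * j)) ⟩
    w ^ (g + b * j)     ≡⟨ cong (w ^_) eq ⟩
    w ^ (a * i)         ≡⟨ ^-* w i a ⟩
    (w ^ i) ^ a         ∎)
    where open ≡-Reasoning

  bézout⇒^∈Gen₂ : ∀ w {d i j} → Bézout.Identity d i j → Gen₂ G (w ^ i) (w ^ j) (w ^ d)
  bézout⇒^∈Gen₂ w {d} {i} {j} (Bézout.+- a b eq) =
    subst (Gen₂ G (w ^ i) (w ^ j)) (sym (^-bézout w {d} {a} {b} {i} {j} eq))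
    (gen-mul (Gen-^ a (gen-base (inj₁ refl))) (gen-inv (Gen-^ b (gen-base (inj₂ refl)))))
  bézout⇒^∈Gen₂ w {d} {i} {j} (Bézout.-+ a b eq) =
    subst (Gen₂ G (w ^ i) (w ^ j)) (sym (^-bézout w {d} {b} {a} {j} {i} eq))
    (gen-mul (Gen-^ b (gen-base (inj₂ refl))) (gen-inv (Gen-^ a (gen-base (inj₁ refl)))))

  ^gcd∈Gen₂ : ∀ w i j → Gen₂ G (w ^ i) (w ^ j) (w ^ gcd i j)
  ^gcd∈Gen₂ w i j = bézout⇒^∈Gen₂ w (Bézout.identity (gcd-GCD i j))

  ^gcd∈⟨^⟩ : ∀ j → HasOrder G z m → z ^ gcd j m ∈⟨ z ^ j ⟩
  ^gcd∈⟨^⟩ {z} {m} j (_ , zᵐ≡e , _) = Gen₁⇒∈⟨⟩ (Gen-mono drop-e (^gcd∈Gen₂ z j m))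
    where
    drop-e : ∀ {x} → x ≡ z ^ j ⊎ x ≡ z ^ m → Gen₁ G (z ^ j) x
    drop-e (inj₁ refl) = gen-base refl
    drop-e (inj₂ refl) = subst (Gen₁ G (z ^ j)) (sym zᵐ≡e) gen-e

  order∣⇒∈⟨⟩ : x ∈⟨ z ⟩ → y ∈⟨ z ⟩ → HasOrder G x d → HasOrder G y d′ → d ∣ d′ → x ∈⟨ y ⟩
  order∣⇒∈⟨⟩ {z = z} {d = d} {d′} (i , refl) (j , refl) x-order y-order d∣d′ with order-exists z
  ... | m , z-order with gcd[m,n]∣n j m
  ... | divides u m≡u*δ = ∈⟨⟩-trans (∣⇒^∈⟨^⟩ δ∣i) (^gcd∈⟨^⟩ j z-order)
    where
    δ : ℕ
    δ = gcd j m
    h-order : HasOrder G (z ^ δ) u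
    h-order = order-^ (subst (HasOrder G z) m≡u*δ z-order)
    u≡d′ : u ≡ d′
    u≡d′ = ∣-antisym (∈⟨⟩⇒order∣ (^gcd∈⟨^⟩ j z-order) y-order h-order)
                     (∈⟨⟩⇒order∣ (∣⇒^∈⟨^⟩ (gcd[m,n]∣m j m)) h-order y-order)
    δ∣i : δ ∣ i
    δ∣i = *-cancelˡ-∣ u {{>-nonZero (proj₁ h-order)}} (begin
      u * δ ≡⟨ sym m≡u*δ ⟩
      m     ∣⟨ ^≡e⇒order∣ z-order (trans (^-* z i d) (proj₁ (proj₂ x-order))) ⟩
      d * i ∣⟨ *-monoˡ-∣ i (subst (d ∣_) (sym u≡d′) d∣d′) ⟩
      u * i ∎)
      where open ∣-Reasoning

  -- Linked x y iff x ≡ y or x, y are adjacent in 𝒫_e(G): Linked x is the closed neighbourhood of x.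
  Linked : Elem G → Elem G → Set
  Linked x y = ∃ λ w → x ∈⟨ w ⟩ × y ∈⟨ w ⟩

  Linked-sym : Linked x y → Linked y x
  Linked-sym (w , x∈ , y∈) = w , y∈ , x∈

  ∈⟨⟩⇒Linked⊆ : x ∈⟨ y ⟩ → Linked y ⊆ Linked x
  ∈⟨⟩⇒Linked⊆ x∈⟨y⟩ (w , y∈⟨w⟩ , u∈⟨w⟩) = w , ∈⟨⟩-trans x∈⟨y⟩ y∈⟨w⟩ , u∈⟨w⟩

  cyclic⇒Linked : IsCyclic G (Gen₂ G x y) → Linked x y
  cyclic⇒Linked (w , gen) = w , Gen₁⇒∈⟨⟩ (Equivalence.to (gen _) (gen-base (inj₁ refl)))
                              , Gen₁⇒∈⟨⟩ (Equivalence.to (gen _) (gen-base (inj₂ refl)))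

  Linked⇒cyclic : Linked x y → IsCyclic G (Gen₂ G x y)
  Linked⇒cyclic (w , (i , refl) , (j , refl)) = w ^ gcd i j , λ _ → mk⇔
    (Gen-mono λ { (inj₁ refl) → ∈⟨⟩⇒Gen₁ (∣⇒^∈⟨^⟩ (gcd[m,n]∣m i j))
                ; (inj₂ refl) → ∈⟨⟩⇒Gen₁ (∣⇒^∈⟨^⟩ (gcd[m,n]∣n i j)) })
    (Gen-mono λ { refl → ^gcd∈Gen₂ w i j })

  Adj⇒Linked : Adj G x y → Linked x y
  Adj⇒Linked (_ , cyclic) = cyclic⇒Linked cyclic

  Linked⇒Adj : x ≢ y → Linked x y → Adj G x y
  Linked⇒Adj x≢y linked = x≢y , Linked⇒cyclic linked

  NestedNeighbourhoods : Set
  NestedNeighbourhoods = ∀ {x y} → Linked x y → Linked x ⊆ Linked y ⊎ Linked y ⊆ Linked x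

  nested⇒cograph : NestedNeighbourhoods → Cograph G
  nested⇒cograph nested a b c d (_ , a≢c , _ , _ , b≢d , _ , ab , bc , cd , ¬ac , _ , ¬bd)
    with nested (Adj⇒Linked bc)
  ... | inj₁ Nb⊆Nc = ¬ac (Linked⇒Adj a≢c (Linked-sym (Nb⊆Nc (Linked-sym (Adj⇒Linked ab)))))
  ... | inj₂ Nc⊆Nb = ¬bd (Linked⇒Adj b≢d (Nc⊆Nb (Adj⇒Linked cd)))

  nested⇒chordal : NestedNeighbourhoods → Chordal G
  nested⇒chordal nested .(4 + k) (s≤s (s≤s (s≤s (s≤s {n = k} _)))) c (c-inj , c-adj) =
    [ (λ N₁⊆N₂ → ¬consec₂₀ (consec (# 2) (# 0) (λ ()) (N₁⊆N₂ (linked (# 1) (# 0) (λ ()) (inj₂ (inj₁ refl))))))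
    , (λ N₂⊆N₁ → ¬consec₁₃ (consec (# 1) (# 3) (λ ()) (N₂⊆N₁ (linked (# 2) (# 3) (λ ()) (inj₁ (inj₁ refl))))))
    ]′ (nested (linked (# 1) (# 2) (λ ()) (inj₁ (inj₁ refl))))
    where
    linked : ∀ i j → i ≢ j → Consec G i j → Linked (c i) (c j)
    linked i j i≢j = Adj⇒Linked ∘ Equivalence.from (c-adj i j i≢j)
    consec : ∀ i j → i ≢ j → Linked (c i) (c j) → Consec G i j
    consec i j i≢j = Equivalence.to (c-adj i j i≢j) ∘ Linked⇒Adj (i≢j ∘ c-inj)
    ¬consec₂₀ : ¬ Consec G {4 + k} (# 2) (# 0)
    ¬consec₂₀ (inj₁ (inj₁ ()))
    ¬consec₂₀ (inj₁ (inj₂ (() , _)))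
    ¬consec₂₀ (inj₂ (inj₁ ()))
    ¬consec₂₀ (inj₂ (inj₂ (() , _)))
    ¬consec₁₃ : ¬ Consec G {4 + k} (# 1) (# 3)
    ¬consec₁₃ (inj₁ (inj₁ ()))
    ¬consec₁₃ (inj₁ (inj₂ (() , _)))
    ¬consec₁₃ (inj₂ (inj₁ ()))
    ¬consec₁₃ (inj₂ (inj₂ (_ , ())))

  OrdersAdmissible : ℕ → ℕ → Set
  OrdersAdmissible r s = ∀ {g k} → HasOrder G g k → Admissible r s k

  record CentralElement : Set where
    field
      {r s}             : ℕ
      r-prime           : Prime r
      s-prime           : Prime s
      r≢s               : r ≢ s
      orders-admissible : OrdersAdmissible r s
      a                 : Elem G
      a-order           : HasOrder G a r
      a-central         : HasOrder G w (r * s) → a ∈⟨ w ⟩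

  module _ (central : CentralElement) where
    open CentralElement central
    open AdmissibleOrders r-prime s-prime r≢s

    private
      s-neighbours⊆r-neighbours : HasOrder G z m → x ∈⟨ z ⟩ → y ∈⟨ z ⟩ → HasOrder G x r → HasOrder G y s
                                → Linked y ⊆ Linked x
      s-neighbours⊆r-neighbours {z} {m} {x} {y} z-order x∈⟨z⟩ y∈⟨z⟩ x-order y-order (w , y∈⟨w⟩ , u∈⟨w⟩)
        with order-exists w
      ... | k , w-order with s∣⇒≡s⊎≡r*s (∈⟨⟩⇒order∣ y∈⟨w⟩ w-order y-order) (orders-admissible w-order)
      ... | inj₁ refl = z , x∈⟨z⟩ , ∈⟨⟩-trans (∈⟨⟩-trans u∈⟨w⟩ w∈⟨y⟩) y∈⟨z⟩
        where
        w∈⟨y⟩ : w ∈⟨ y ⟩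
        w∈⟨y⟩ = order∣⇒∈⟨⟩ ∈⟨⟩-refl y∈⟨w⟩ w-order y-order ∣-refl
      ... | inj₂ refl = w , ∈⟨⟩-trans x∈⟨a⟩ (a-central w-order) , u∈⟨w⟩
        where
        m≡rs : m ≡ r * s
        m≡rs = r∣∧s∣⇒≡r*s (∈⟨⟩⇒order∣ x∈⟨z⟩ z-order x-order) (∈⟨⟩⇒order∣ y∈⟨z⟩ z-order y-order)
                          (orders-admissible z-order)
        x∈⟨a⟩ : x ∈⟨ a ⟩
        x∈⟨a⟩ = order∣⇒∈⟨⟩ x∈⟨z⟩ (a-central (subst (HasOrder G z) m≡rs z-order)) x-order a-order ∣-refl

    central⇒nested : NestedNeighbourhoods
    central⇒nested {x} {y} (z , x∈⟨z⟩ , y∈⟨z⟩)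
      with order-exists x | order-exists y | order-exists z
    ... | dx , x-order | dy , y-order | m , z-order with dx ∣? dy | dy ∣? dx
    ... | yes dx∣dy | _ = inj₂ (∈⟨⟩⇒Linked⊆ (order∣⇒∈⟨⟩ x∈⟨z⟩ y∈⟨z⟩ x-order y-order dx∣dy))
    ... | no _ | yes dy∣dx = inj₁ (∈⟨⟩⇒Linked⊆ (order∣⇒∈⟨⟩ y∈⟨z⟩ x∈⟨z⟩ y-order x-order dy∣dx))
    ... | no dx∤dy | no dy∤dx
      with incomparable⇒r,s (orders-admissible x-order) (orders-admissible y-order) (orders-admissible z-order)
             (∈⟨⟩⇒order∣ x∈⟨z⟩ z-order x-order) (∈⟨⟩⇒order∣ y∈⟨z⟩ z-order y-order) dx∤dy dy∤dx
    ... | inj₁ (refl , refl) = inj₂ (s-neighbours⊆r-neighbours z-order x∈⟨z⟩ y∈⟨z⟩ x-order y-order)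
    ... | inj₂ (refl , refl) = inj₁ (s-neighbours⊆r-neighbours z-order y∈⟨z⟩ x∈⟨z⟩ y-order x-order)

  central⇒chordal×cograph : CentralElement → Chordal G × Cograph G
  central⇒chordal×cograph central = nested⇒chordal (central⇒nested central) , nested⇒cograph (central⇒nested central)

  spectrumPQ⇒admissible : SpectrumPQ G p q → OrdersAdmissible p q
  spectrumPQ⇒admissible spectrum g-order with Equivalence.to (spectrum _) (_ , g-order)
  ... | inj₁ refl                 = is-1
  ... | inj₂ (inj₁ refl)          = is-r
  ... | inj₂ (inj₂ (inj₁ refl))   = is-s
  ... | inj₂ (inj₂ (inj₂ refl))   = is-rs

  spectrumPQ⇒admissible-swap : SpectrumPQ G p q → OrdersAdmissible q p
  spectrumPQ⇒admissible-swap {p} {q} spectrum g-order with Equivalence.to (spectrum _) (_ , g-order)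
  ... | inj₁ refl                 = is-1
  ... | inj₂ (inj₁ refl)          = is-s
  ... | inj₂ (inj₂ (inj₁ refl))   = is-r
  ... | inj₂ (inj₂ (inj₂ refl))   = inj₂ (inj₂ (inj₂ (inj₁ (*-comm p q))))

  spectrumPQP2⇒admissible : SpectrumPQP2 G p q → OrdersAdmissible p q
  spectrumPQP2⇒admissible spectrum g-order = Equivalence.to (spectrum _) (_ , g-order)

  uniqueSubgroup⇒∈⟨⟩ : UniqueSubgroupOfOrder G p → HasOrder G x p → HasOrder G w (p * q) → x ∈⟨ w ⟩
  uniqueSubgroup⇒∈⟨⟩ {x = x} {w} {q} (_ , _ , _ , unique) x-order w-order =
    ∈⟨⟩-trans (∈⟨⟩ˢ⇒∈⟨⟩ (subst (x ∈_) ⟨x⟩≡⟨wᵠ⟩ (∈⟨⟩⇒∈⟨⟩ˢ ∈⟨⟩-refl))) (q , refl)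
    where
    ⟨x⟩≡⟨wᵠ⟩ : ⟨ x ⟩ˢ ≡ ⟨ w ^ q ⟩ˢ
    ⟨x⟩≡⟨wᵠ⟩ = trans (unique _ (proj₁ (⟨⟩ˢ-cyclicSubgroup x)) (∣⟨⟩ˢ∣≡order x-order))
                 (sym (unique _ (proj₁ (⟨⟩ˢ-cyclicSubgroup (w ^ q))) (∣⟨⟩ˢ∣≡order (order-^ w-order))))

  uniqueCyclicSubgroup⇒∈⟨⟩ : UniqueCyclicSubgroupOfOrder G k → HasOrder G z k → HasOrder G w k → z ∈⟨ w ⟩
  uniqueCyclicSubgroup⇒∈⟨⟩ {z = z} {w} (_ , _ , _ , unique) z-order w-order =
    ∈⟨⟩ˢ⇒∈⟨⟩ (subst (z ∈_) ⟨z⟩≡⟨w⟩ (∈⟨⟩⇒∈⟨⟩ˢ ∈⟨⟩-refl))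
    where
    ⟨z⟩≡⟨w⟩ : ⟨ z ⟩ˢ ≡ ⟨ w ⟩ˢ
    ⟨z⟩≡⟨w⟩ = trans (unique _ (⟨⟩ˢ-cyclicSubgroup z) (∣⟨⟩ˢ∣≡order z-order))
                (sym (unique _ (⟨⟩ˢ-cyclicSubgroup w) (∣⟨⟩ˢ∣≡order w-order)))

  inCycIntersection⇒∈⟨⟩ : InCycIntersection G k x → HasOrder G w k → x ∈⟨ w ⟩
  inCycIntersection⇒∈⟨⟩ x∈∩ w-order = ∈⟨⟩ˢ⇒∈⟨⟩ (x∈∩ _ (⟨⟩ˢ-cyclicSubgroup _) (∣⟨⟩ˢ∣≡order w-order))

  inCycIntersection-closed : InCycIntersection G k w → x ∈⟨ w ⟩ → InCycIntersection G k x
  inCycIntersection-closed w∈∩ x∈⟨w⟩ H H-cyclic ∣H∣≡k = subgroup-closed-∈⟨⟩ (proj₁ H-cyclic) (w∈∩ H H-cyclic ∣H∣≡k) x∈⟨w⟩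

  module _ (p-prime : Prime p) (q-prime : Prime q) (p≢q : p ≢ q) where

    uniqueCyclic⇒central : OrdersAdmissible p q → InSpectrum G (p * q)
                         → UniqueCyclicSubgroupOfOrder G (p * q) → CentralElement
    uniqueCyclic⇒central admissible (z , z-order) unique = record
      { r-prime = p-prime ; s-prime = q-prime ; r≢s = p≢q ; orders-admissible = admissible
      ; a = z ^ q ; a-order = order-^ z-order
      ; a-central = λ w-order → ∈⟨⟩-trans (q , refl) (uniqueCyclicSubgroup⇒∈⟨⟩ unique z-order w-order)
      }

    intersection⇒central : OrdersAdmissible p q
                         → InCycIntersection G (p * q) x → HasOrder G x p → CentralElement
    intersection⇒central admissible x∈∩ x-order = record
      { r-prime = p-prime ; s-prime = q-prime ; r≢s = p≢q ; orders-admissible = admissible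
      ; a = _ ; a-order = x-order ; a-central = inCycIntersection⇒∈⟨⟩ x∈∩
      }

    cyclicizer∧order-q⇒¬order-p*p : OrdersAdmissible p q
                                  → InCyc G x → HasOrder G x q → ¬ InSpectrum G (p * p)
    cyclicizer∧order-q⇒¬order-p*p admissible x∈Cyc x-order (y , y-order) with cyclic⇒Linked (x∈Cyc y)
    ... | w , x∈⟨w⟩ , y∈⟨w⟩ with order-exists w
    ... | m , w-order = AdmissibleOrders.r*r∣∧s∣⇒¬admissible p-prime q-prime p≢q
          (∈⟨⟩⇒order∣ y∈⟨w⟩ w-order y-order) (∈⟨⟩⇒order∣ x∈⟨w⟩ w-order x-order) (admissible w-order)

  condA⇒central : Prime p → Prime q → p ≢ q → CondA G p q → CentralElement
  condA⇒central {p} {q} p-prime q-prime p≢q (spectrum , inj₁ unique-p)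
    with Equivalence.from (spectrum p) (inj₂ (inj₁ refl))
  ... | x , x-order = record
    { r-prime = p-prime ; s-prime = q-prime ; r≢s = p≢q
    ; orders-admissible = spectrumPQ⇒admissible spectrum
    ; a = x ; a-order = x-order ; a-central = uniqueSubgroup⇒∈⟨⟩ unique-p x-order
    }
  condA⇒central {p} {q} p-prime q-prime p≢q (spectrum , inj₂ unique-q)
    with Equivalence.from (spectrum q) (inj₂ (inj₂ (inj₁ refl)))
  ... | x , x-order = record
    { r-prime = q-prime ; s-prime = p-prime ; r≢s = p≢q ∘ sym
    ; orders-admissible = spectrumPQ⇒admissible-swap spectrum
    ; a = x ; a-order = x-order ; a-central = uniqueSubgroup⇒∈⟨⟩ unique-q x-order
    }

  smallIntersection⇒central : Prime p → Prime q → p ≢ q → SpectrumPQ G p q → (I : Subset n)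
                            → (∀ g → g ∈ I ⇔ InCycIntersection G (p * q) g) → ∣ I ∣ ≡ p ⊎ ∣ I ∣ ≡ q
                            → CentralElement
  smallIntersection⇒central {p} {q} p-prime q-prime p≢q spectrum I I≡∩ ∣I∣≡p⊎q
    with ∣S∣>1⇒∃≢ e I (case ∣I∣≡p⊎q of λ { (inj₁ refl) → prime>1 p-prime ; (inj₂ refl) → prime>1 q-prime })
  ... | x , x∈I , x≢e with order-exists x | Equivalence.to (I≡∩ x) x∈I
  ... | k , x-order | x∈∩ with Equivalence.to (spectrum k) (x , x-order)
  ... | inj₁ refl = ⊥-elim (x≢e (trans (sym (identityʳ x)) (proj₁ (proj₂ x-order))))
  ... | inj₂ (inj₁ refl) = intersection⇒central p-prime q-prime p≢q (spectrumPQ⇒admissible spectrum) x∈∩ x-order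
  ... | inj₂ (inj₂ (inj₁ refl)) = intersection⇒central q-prime p-prime (p≢q ∘ sym)
          (spectrumPQ⇒admissible-swap spectrum) (subst (λ k → InCycIntersection G k x) (*-comm p q) x∈∩) x-order
  ... | inj₂ (inj₂ (inj₂ refl)) = ⊥-elim (<⇒≱ (∣I∣<p*q ∣I∣≡p⊎q) p*q≤∣I∣)
    where
    p*q≤∣I∣ : p * q ≤ ∣ I ∣
    p*q≤∣I∣ = subst (_≤ ∣ I ∣) (∣⟨⟩ˢ∣≡order x-order) (p⊆q⇒∣p∣≤∣q∣ λ y∈⟨x⟩ →
      Equivalence.from (I≡∩ _) (inCycIntersection-closed x∈∩ (∈⟨⟩ˢ⇒∈⟨⟩ y∈⟨x⟩)))
    ∣I∣<p*q : ∣ I ∣ ≡ p ⊎ ∣ I ∣ ≡ q → ∣ I ∣ < p * q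
    ∣I∣<p*q (inj₁ refl) = m<m*n p q {{prime⇒nonZero p-prime}} (prime>1 q-prime)
    ∣I∣<p*q (inj₂ refl) = subst (q <_) (*-comm q p) (m<m*n q p {{prime⇒nonZero q-prime}} (prime>1 p-prime))

  condB⇒central : Prime p → Prime q → p ≢ q → CondB G p q → CentralElement
  condB⇒central p-prime q-prime p≢q (spectrum , inj₁ unique) =
    uniqueCyclic⇒central p-prime q-prime p≢q (spectrumPQ⇒admissible spectrum)
      (Equivalence.from (spectrum _) (inj₂ (inj₂ (inj₂ refl)))) unique
  condB⇒central p-prime q-prime p≢q (spectrum , inj₂ (I , I≡∩ , ∣I∣≡p⊎q)) =
    smallIntersection⇒central p-prime q-prime p≢q spectrum I I≡∩ ∣I∣≡p⊎q

  condC⇒central : Prime p → Prime q → p ≢ q → CondC G p q → CentralElement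
  condC⇒central p-prime q-prime p≢q (spectrum , inj₁ unique) =
    uniqueCyclic⇒central p-prime q-prime p≢q (spectrumPQP2⇒admissible spectrum)
      (Equivalence.from (spectrum _) is-rs) unique
  condC⇒central p-prime q-prime p≢q (spectrum , inj₂ (x , _ , inj₁ x-order , ∩≡⟨x⟩)) =
    intersection⇒central p-prime q-prime p≢q (spectrumPQP2⇒admissible spectrum)
      (Equivalence.from (∩≡⟨x⟩ x) (gen-base refl)) x-order
  condC⇒central p-prime q-prime p≢q (spectrum , inj₂ (x , x∈Cyc , inj₂ x-order , _)) =
    ⊥-elim (cyclicizer∧order-q⇒¬order-p*p p-prime q-prime p≢q (spectrumPQP2⇒admissible spectrum)
      x∈Cyc x-order (Equivalence.from (spectrum _) is-rr))

proposition4p17 : (G : FinGroup) (p q : ℕ) → Prime p → Prime q → p ≢ q → (CondA G p q ⊎ CondB G p q ⊎ CondC G p q) → Chordal G × Cograph G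
proposition4p17 G p q p-prime q-prime p≢q =
  central⇒chordal×cograph G ∘
  [ condA⇒central G p-prime q-prime p≢q
  , [ condB⇒central G p-prime q-prime p≢q , condC⇒central G p-prime q-prime p≢q ]′ ]′
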